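{- Let $m,n\in\mathbb{N}$ and let $g:T_m\to T_n$ be a dimension-preserving graph morphism. Then the image of $g$ (on vertices) is a face of $T_n$: there is a function $f:\{0,\dots,n-1\}\to\{0,1,\star\}$ such that the image of $g$ equals the set of vertices $x_0\cdots x_{n-1}$ of $T_n$ with $f(i)\in\{x_i,\star\}$ for all $i$.
   Context: A graph is $(V,E)$ with $E\subseteq V\times V$; a graph morphism $(V,E)\to(V',E')$ is $f:V\to V'$ with $(s,t)\in E\Rightarrow(f(s),f(t))\in E'$, sending edge $(s,t)$ to edge $(f(s),f(t))$. The twisted $n$-cube $T_n$ has vertex set $\{0,1\}^n$ and edges: a loop at each vertex, and for each $i\in\{0,\dots,n-1\}$ and $y\in\{0,1\}^{n-1}$ an edge from $y_0\cdots y_{i-1}\,b\,y_i\cdots y_{n-2}$ to $y_0\cdots y_{i-1}\,(1-b)\,y_i\cdots y_{n-2}$, where $b=1$ if the number of zeros among $y_0,\dots,y_{i-1}$ is odd and $b=0$ otherwise. The dimension of a loop is "trivial"; that of a non-loop edge joining vertices differing in coordinate $i$ is $i$. A graph morphism $g:T_m\to T_n$ is dimension-preserving if any two edges of $T_m$ with equal dimension are sent to edges with equal dimension. A face of $T_n$ is a function $f:\{0,\dots,n-1\}\to\{0,1,\star\}$; it represents the set of vertices $x$ with $f(i)\in\{x_i,\star\}$ for all $i$. -}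

module Defs where

open import Data.Bool using (Bool; true; false; not; if_then_else_)
open import Data.Nat using (ℕ; suc)
open import Data.Fin using (Fin; zero; suc)
open import Data.Vec using (Vec; []; _∷_; insertAt; lookup)
open import Data.Maybe using (Maybe; just; nothing)
open import Data.Product using (Σ; _×_)
open import Data.Sum using (_⊎_)
open import Relation.Binary.PropositionalEquality using (_≡_)

Vertex : ℕ → Set
Vertex n = Vec Bool n

zerosOdd : ∀ {k} → Fin (suc k) → Vec Bool k → Bool
zerosOdd zero    y       = false
zerosOdd (suc i) (x ∷ y) = if x then zerosOdd i y else not (zerosOdd i y)

-- Edges of the twisted n-cube T_n (0 = false, 1 = true).
-- step i y : the edge from y_0..y_{i-1} b y_i..y_{n-2} to y_0..y_{i-1} (1-b) y_i..y_{n-2}.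
data Edge : {n : ℕ} → Vertex n → Vertex n → Set where
  loop : ∀ {n} (x : Vertex n) → Edge x x
  step : ∀ {k} (i : Fin (suc k)) (y : Vec Bool k) →
         Edge (insertAt y i (zerosOdd i y)) (insertAt y i (not (zerosOdd i y)))

-- Dimension of an edge: nothing = "trivial" (loop), just i = dimension i.
-- (Edges between given endpoints are unique, so this depends only on the endpoints.)
dim : ∀ {n} {s t : Vertex n} → Edge s t → Maybe (Fin n)
dim (loop x)   = nothing
dim (step i y) = just i

record Morphism (m n : ℕ) : Set where
  field
    fun  : Vertex m → Vertex n
    edge : ∀ {s t} → Edge s t → Edge (fun s) (fun t)

open Morphism public

DimensionPreserving : ∀ {m n} → Morphism m n → Set
DimensionPreserving {m} g =
  ∀ {s t s' t' : Vertex m} (e : Edge s t) (e' : Edge s' t') →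
  dim e ≡ dim e' → dim (edge g e) ≡ dim (edge g e')

data Tri : Set where
  t0 t1 ⋆ : Tri

bit : Bool → Tri
bit false = t0
bit true  = t1

Face : ℕ → Set
Face n = Fin n → Tri

InFace : ∀ {n} → Face n → Vertex n → Set
InFace f x = ∀ i → (f i ≡ bit (lookup x i)) ⊎ (f i ≡ ⋆)

InImage : ∀ {m n} → Morphism m n → Vertex n → Set
InImage {m} g x = Σ (Vertex m) λ v → fun g v ≡ x

-- Every dimension-i edge of T_m joins x to x with its i-th bit flipped, and between any x and
-- that flip there is an edge of dimension i (in one of the two directions). So a
-- dimension-preserving g sends flipping bit i to flipping a fixed bit d(i) of T_n (or to doing
-- nothing, when d(i) is trivial). Since every vertex is reached from 0 by flips, the image of g
-- is g(0) with any combination of the bits in the range of d flipped: the face that is ⋆ on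
-- that range and agrees with g(0) elsewhere.
module Submission where

open import Defs
open import Data.Bool using (Bool; true; false; not)
open import Data.Bool.Properties using (not-involutive; ¬-not) renaming (_≟_ to _≟ᵇ_)
open import Data.Empty using (⊥-elim)
open import Data.Fin using (Fin; zero; suc)
open import Data.Fin.Properties using (any?) renaming (_≟_ to _≟ᶠ_)
open import Data.List using ([]; _∷_; foldr; map)
open import Data.List.Relation.Unary.All using (All; []; _∷_)
open import Data.List.Relation.Unary.All.Properties using (map⁺)
open import Data.Maybe using (Maybe; just; nothing)
open import Data.Maybe.Properties using (≡-dec)
open import Data.Nat using (ℕ)
open import Data.Product using (Σ; ∃; _×_; _,_; proj₁)
open import Data.Sum using (_⊎_; inj₁; inj₂)
open import Data.Unit using (⊤; tt)
open import Data.Vec using (Vec; []; _∷_; insertAt; removeAt; lookup; replicate; updateAt)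
open import Data.Vec.Properties
  using (updateAt-updateAt; updateAt-cong; updateAt-id; insertAt-removeAt; lookup∘updateAt′)
open import Relation.Nullary using (¬_; yes; no)
open import Level using (0ℓ)
open import Relation.Unary using (Pred; Decidable)
open import Relation.Binary.PropositionalEquality

flipAt : ∀ {n} → Fin n → Vertex n → Vertex n
flipAt i x = updateAt x i not

flipAt-involutive : ∀ {n} (i : Fin n) x → flipAt i (flipAt i x) ≡ x
flipAt-involutive i x = begin
  updateAt (updateAt x i not) i not ≡⟨ updateAt-updateAt i x ⟩
  updateAt x i (λ b → not (not b))  ≡⟨ updateAt-cong i not-involutive x ⟩
  updateAt x i (λ b → b)            ≡⟨ updateAt-id i x ⟩
  x                                 ∎
  where open ≡-Reasoning

flipAt-insertAt : ∀ {k} (y : Vec Bool k) i c → flipAt i (insertAt y i c) ≡ insertAt y i (not c)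
flipAt-insertAt y       zero    c = refl
flipAt-insertAt (a ∷ y) (suc i) c = cong (a ∷_) (flipAt-insertAt y i c)

flipAt-as-insertAt : ∀ {k} (x : Vertex (ℕ.suc k)) i →
  flipAt i x ≡ insertAt (removeAt x i) i (not (lookup x i))
flipAt-as-insertAt x i = begin
  flipAt i x                                       ≡⟨ cong (flipAt i) (sym (insertAt-removeAt x i)) ⟩
  flipAt i (insertAt (removeAt x i) i (lookup x i)) ≡⟨ flipAt-insertAt (removeAt x i) i (lookup x i) ⟩
  insertAt (removeAt x i) i (not (lookup x i))     ∎
  where open ≡-Reasoning

flipDim : ∀ {n} → Maybe (Fin n) → Vertex n → Vertex n
flipDim nothing  x = x
flipDim (just i) x = flipAt i x

flipDim-involutive : ∀ {n} md (x : Vertex n) → flipDim md (flipDim md x) ≡ x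
flipDim-involutive nothing  x = refl
flipDim-involutive (just i) x = flipAt-involutive i x

flipDim-swap : ∀ {n} md {s t : Vertex n} → t ≡ flipDim md s → s ≡ flipDim md t
flipDim-swap md {s} refl = sym (flipDim-involutive md s)

lookup-flipDim : ∀ {n} md (x : Vertex n) j → md ≢ just j → lookup (flipDim md x) j ≡ lookup x j
lookup-flipDim nothing  x j _   = refl
lookup-flipDim (just i) x j i≢j = lookup∘updateAt′ j i (λ j≡i → i≢j (cong just (sym j≡i))) x

edge-target : ∀ {n} {s t : Vertex n} (e : Edge s t) → t ≡ flipDim (dim e) s
edge-target (loop x)   = refl
edge-target (step i y) = sym (flipAt-insertAt y i _)

EdgeOfDim : ∀ {n} → Fin n → Vertex n → Vertex n → Set
EdgeOfDim i s t = Σ (Edge s t) λ e → dim e ≡ just i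

Linked : ∀ {n} → Fin n → Vertex n → Vertex n → Set
Linked i s t = EdgeOfDim i s t ⊎ EdgeOfDim i t s

-- The edge step i y has the right endpoints for exactly one of the two values of the bit c.
insertAt-linked : ∀ {k} (y : Vec Bool k) i c → Linked i (insertAt y i c) (insertAt y i (not c))
insertAt-linked y i c = orient c (zerosOdd i y) (step i y , refl)
  where
  orient : ∀ c z → EdgeOfDim i (insertAt y i z) (insertAt y i (not z)) →
           Linked i (insertAt y i c) (insertAt y i (not c))
  orient false false e = inj₁ e
  orient false true  e = inj₂ e
  orient true  false e = inj₂ e
  orient true  true  e = inj₁ e

flipAt-linked : ∀ {n} (x : Vertex n) i → Linked i x (flipAt i x)
flipAt-linked {ℕ.suc k} x i =
  subst₂ (Linked i) (insertAt-removeAt x i) (sym (flipAt-as-insertAt x i))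
    (insertAt-linked (removeAt x i) i (lookup x i))

foldr-flipAt-suc : ∀ {n} c (x : Vertex n) J →
  foldr flipAt (c ∷ x) (map suc J) ≡ c ∷ foldr flipAt x J
foldr-flipAt-suc c x []      = refl
foldr-flipAt-suc c x (j ∷ J) = cong (flipAt (suc j)) (foldr-flipAt-suc c x J)

flips-between : ∀ {n} (P : Pred (Fin n) 0ℓ) → Decidable P → (x b : Vertex n) →
  (∀ j → ¬ P j → lookup x j ≡ lookup b j) → ∃ λ J → All P J × foldr flipAt b J ≡ x
flips-between P P? []      []      _     = [] , [] , refl
flips-between P P? (a ∷ x) (c ∷ b) agree
  with flips-between (λ j → P (suc j)) (λ j → P? (suc j)) x b (λ j → agree (suc j))
... | J , PJ , x≡ with a ≟ᵇ c | P? zero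
...   | yes refl | _      = map suc J , map⁺ PJ , trans (foldr-flipAt-suc c b J) (cong (c ∷_) x≡)
...   | no  a≢c  | yes P0 = zero ∷ map suc J , P0 ∷ map⁺ PJ ,
                            trans (cong (flipAt zero) (foldr-flipAt-suc c b J)) (cong₂ _∷_ (sym (¬-not a≢c)) x≡)
...   | no  a≢c  | no ¬P0 = ⊥-elim (a≢c (agree zero ¬P0))

reachable-from-zero : ∀ {m} (v : Vertex m) → ∃ λ I → foldr flipAt (replicate m false) I ≡ v
reachable-from-zero v =
  let I , _ , eq = flips-between (λ _ → ⊤) (λ _ → yes tt) v _ (λ _ ¬⊤ → ⊥-elim (¬⊤ tt))
  in I , eq

bit-injective : ∀ {a b} → bit a ≡ bit b → a ≡ b
bit-injective {false} {false} _ = refl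
bit-injective {true}  {true}  _ = refl

bit≢⋆ : ∀ {a} → bit a ≢ ⋆
bit≢⋆ {false} ()
bit≢⋆ {true}  ()

module DimensionPreservingMorphism {m n : ℕ} (g : Morphism m n) (dp : DimensionPreserving g) where

  G : Vertex m → Vertex n
  G = fun g

  dimImage : Fin m → Maybe (Fin n)
  dimImage i with flipAt-linked (replicate m false) i
  ... | inj₁ (e , _) = dim (edge g e)
  ... | inj₂ (e , _) = dim (edge g e)

  dim-edge-image : ∀ {s t} i → (e : EdgeOfDim i s t) → dim (edge g (proj₁ e)) ≡ dimImage i
  dim-edge-image i (e , e-i) with flipAt-linked (replicate m false) i
  ... | inj₁ (e₀ , e₀-i) = dp e e₀ (trans e-i (sym e₀-i))
  ... | inj₂ (e₀ , e₀-i) = dp e e₀ (trans e-i (sym e₀-i))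

  G-flipAt : ∀ x i → G (flipAt i x) ≡ flipDim (dimImage i) (G x)
  G-flipAt x i with flipAt-linked x i
  ... | inj₁ e = subst (λ md → G (flipAt i x) ≡ flipDim md (G x)) (dim-edge-image i e)
                   (edge-target (edge g (proj₁ e)))
  ... | inj₂ e = flipDim-swap (dimImage i)
                   (subst (λ md → G x ≡ flipDim md (G (flipAt i x))) (dim-edge-image i e)
                     (edge-target (edge g (proj₁ e))))

  InRange : Pred (Fin n) 0ℓ
  InRange j = ∃ λ i → dimImage i ≡ just j

  InRange? : Decidable InRange
  InRange? j = any? (λ i → ≡-dec _≟ᶠ_ (dimImage i) (just j))

  base : Vertex n
  base = G (replicate m false)

  image-outside-range : ∀ v j → ¬ InRange j → lookup (G v) j ≡ lookup base j
  image-outside-range v j j∉ with reachable-from-zero v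
  ... | I , refl = along I
    where
    along : ∀ I → lookup (G (foldr flipAt (replicate m false) I)) j ≡ lookup base j
    along []      = refl
    along (i ∷ I) = begin
      lookup (G (flipAt i w)) j               ≡⟨ cong (λ y → lookup y j) (G-flipAt w i) ⟩
      lookup (flipDim (dimImage i) (G w)) j   ≡⟨ lookup-flipDim (dimImage i) (G w) j (λ d≡j → j∉ (i , d≡j)) ⟩
      lookup (G w) j                          ≡⟨ along I ⟩
      lookup base j                           ∎
      where
      open ≡-Reasoning
      w = foldr flipAt (replicate m false) I

  flips-in-range-reachable : ∀ J → All InRange J → ∃ λ v → G v ≡ foldr flipAt base J
  flips-in-range-reachable []      []                  = replicate m false , refl
  flips-in-range-reachable (j ∷ J) ((i , d≡j) ∷ J-in) =
    let v , Gv≡ = flips-in-range-reachable J J-in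
    in flipAt i v , trans (G-flipAt v i) (trans (cong (λ md → flipDim md (G v)) d≡j) (cong (flipAt j) Gv≡))

  face : Face n
  face j with InRange? j
  ... | yes _ = ⋆
  ... | no  _ = bit (lookup base j)

  image⊆face : ∀ v → InFace face (G v)
  image⊆face v j with InRange? j
  ... | yes _  = inj₂ refl
  ... | no  j∉ = inj₁ (cong bit (sym (image-outside-range v j j∉)))

  face-outside-range : ∀ x → InFace face x → ∀ j → ¬ InRange j → lookup x j ≡ lookup base j
  face-outside-range x x∈ j j∉ with InRange? j | x∈ j
  ... | yes j∈ | _           = ⊥-elim (j∉ j∈)
  ... | no  _  | inj₁ bit≡   = bit-injective (sym bit≡)
  ... | no  _  | inj₂ bit≡⋆  = ⊥-elim (bit≢⋆ bit≡⋆)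

  face⊆image : ∀ x → InFace face x → InImage g x
  face⊆image x x∈ =
    let J , J-in , x≡ = flips-between InRange InRange? x base (face-outside-range x x∈)
        v , Gv≡ = flips-in-range-reachable J J-in
    in v , trans Gv≡ x≡

lemma3p12 : (m n : ℕ) (g : Morphism m n) → DimensionPreserving g →
    Σ (Face n) λ f → ∀ x → (InImage g x → InFace f x) × (InFace f x → InImage g x)
lemma3p12 m n g dp = face , λ x → (λ { (v , refl) → image⊆face v }) , face⊆image x
  where open DimensionPreservingMorphism g dp
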